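{- The system $(\mathbf{EN})^\Delta$ (axiomatized by TAUT, $\Delta$Equ, $\Delta$N and the rules modus ponens and RE$\Delta$) is sound and strongly complete with respect to the class of all neighborhood frames satisfying $(n)$.
   Context: The language $\mathcal{L}(\Delta)$ is given by $\phi::=p\mid\neg\phi\mid\phi\land\phi\mid\Delta\phi$ with $p$ ranging over a fixed countably infinite set $\mathbf{P}$ of propositional variables; $\top$ is a fixed tautology. A neighborhood model is $\mathcal{M}=\langle S,N,V\rangle$ with $S\neq\emptyset$, $N:S\to\mathcal{P}(\mathcal{P}(S))$, $V:\mathbf{P}\to\mathcal{P}(S)$. Truth: $\mathcal{M},s\vDash p$ iff $s\in V(p)$; Boolean clauses as usual; $\mathcal{M},s\vDash\Delta\phi$ iff $\phi^{\mathcal{M}}\in N(s)$ or $S\setminus\phi^{\mathcal{M}}\in N(s)$, with $\phi^{\mathcal{M}}$ the truth set of $\phi$. A frame satisfies $(n)$ if $S\in N(s)$ for all $s\in S$. Axioms/rules: TAUT (all propositional tautologies), $\Delta$Equ: $\Delta\phi\leftrightarrow\Delta\neg\phi$; $\Delta$N: $\Delta\top$; RE$\Delta$: from $\phi\leftrightarrow\psi$ infer $\Delta\phi\leftrightarrow\Delta\psi$; plus modus ponens. Soundness: every theorem is valid on every frame of the class. Strong completeness: for every set $\Gamma$ and formula $\phi$, if $\phi$ holds at every state of every model on a frame in the class where all of $\Gamma$ holds, then $\phi$ is derivable from $\Gamma$. -}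

module Defs where

open import Data.Nat using (ℕ)
open import Data.Bool using (Bool; true; false; not; _∧_)
open import Data.List using (List; []; _∷_)
open import Data.List.Relation.Unary.All using (All)
open import Data.Product using (Σ; _×_; _,_)
open import Data.Sum using (_⊎_)
open import Data.Unit using (⊤)
open import Relation.Nullary using (¬_; Dec)
open import Relation.Binary.PropositionalEquality using (_≡_)

data Form : Set where
  var : ℕ → Form
  ¬f_ : Form → Form
  _∧f_ : Form → Form → Form
  Δ : Form → Form

infix  6 ¬f_
infixr 5 _∧f_
infixr 4 _⇒f_
infix  3 _⇔f_

_⇒f_ : Form → Form → Form
φ ⇒f ψ = ¬f (φ ∧f ¬f ψ)

_⇔f_ : Form → Form → Form
φ ⇔f ψ = (φ ⇒f ψ) ∧f (ψ ⇒f φ)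

⊤f : Form
⊤f = ¬f (var 0 ∧f ¬f var 0)

-- Propositional tautologies of L(Δ): formulas true under every Boolean
-- assignment to the propositional atoms (variables and Δ-formulas).
evalB : (Form → Bool) → Form → Bool
evalB v (var p)   = v (var p)
evalB v (¬f φ)    = not (evalB v φ)
evalB v (φ ∧f ψ)  = evalB v φ ∧ evalB v ψ
evalB v (Δ φ)     = v (Δ φ)

Tautology : Form → Set
Tautology φ = (v : Form → Bool) → evalB v φ ≡ true

data Thm : Form → Set where
  taut   : ∀ {φ} → Tautology φ → Thm φ
  ΔEqu   : ∀ {φ} → Thm (Δ φ ⇔f Δ (¬f φ))
  ΔN     : Thm (Δ ⊤f)
  mp     : ∀ {φ ψ} → Thm (φ ⇒f ψ) → Thm φ → Thm ψ
  REΔ    : ∀ {φ ψ} → Thm (φ ⇔f ψ) → Thm (Δ φ ⇔f Δ ψ)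

conj : List Form → Form
conj []       = ⊤f
conj (γ ∷ γs) = γ ∧f conj γs

_⊢_ : (Form → Set) → Form → Set
Γ ⊢ φ = Σ (List Form) (λ γs → All Γ γs × Thm (conj γs ⇒f φ))

-- Subsets of S are predicates S → Set; since
-- subsets are extensional, each N(s) must be closed under extensional
-- equality of subsets (this is what makes N(s) a set of *subsets*).
record Frame : Set₁ where
  field
    S      : Set
    point  : S                               -- S ≠ ∅
    N      : S → (S → Set) → Set
    N-ext  : ∀ s (X Y : S → Set) → (∀ t → (X t → Y t) × (Y t → X t)) → N s X → N s Y

open Frame public

HasN : Frame → Set
HasN F = ∀ s → N F s (λ _ → ⊤)

Valuation : Frame → Set₁
Valuation F = ℕ → S F → Set

sat : (F : Frame) → Valuation F → S F → Form → Set
sat F V s (var p)  = V p s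
sat F V s (¬f φ)   = ¬ sat F V s φ
sat F V s (φ ∧f ψ) = sat F V s φ × sat F V s ψ
sat F V s (Δ φ)    = N F s (λ t → sat F V t φ) ⊎ N F s (λ t → ¬ sat F V t φ)

LEM : Set₁
LEM = (A : Set) → Dec A

Sound : Set₁
Sound = ∀ φ → Thm φ → (F : Frame) → HasN F → (V : Valuation F) → (s : S F) → sat F V s φ

StronglyComplete : Set₁
StronglyComplete = (Γ : Form → Set) (φ : Form) →
  ((F : Frame) → HasN F → (V : Valuation F) → (s : S F) →
     (∀ γ → Γ γ → sat F V s γ) → sat F V s φ) →
  Γ ⊢ φ

module Submission where

open import Defs
open import Level using (0ℓ)
open import Data.Bool using (Bool; true; false; not; T; T?)
open import Data.Bool.Properties using (T-≡; T-∧)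
open import Data.Empty using (⊥-elim)
open import Data.List using (List; []; _∷_; _++_)
open import Data.List.Relation.Unary.All as All using (All; []; _∷_)
open import Data.List.Relation.Unary.All.Properties using (++⁺; ++⁻ˡ; ++⁻ʳ)
open import Data.Nat using (ℕ; zero; suc; _⊔_; _≤′_; ≤′-refl; ≤′-step)
open import Data.Nat.Binary as ℕᵇ using (ℕᵇ; 2[1+_]; 1+[2_])
open import Data.Nat.Binary.Properties using (toℕ-injective; 2[1+_]-injective; 1+[2_]-injective)
open import Data.Nat.Properties using (m≤m⊔n; m≤n⊔m; ≤⇒≤′)
open import Data.Product using (_×_; Σ; ∃; ∃₂; _,_; proj₁; proj₂)
open import Data.Sum using (_⊎_; inj₁; inj₂; [_,_]′)
import Data.Sum as Sum
open import Data.Unit using (tt)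
open import Function using (_∘_)
open import Function.Bundles using (_⇔_; mk⇔; Equivalence)
open import Function.Properties.Equivalence as ⇔ using ()
open import Function.Related.TypeIsomorphisms using (¬-cong-⇔)
open import Data.Product.Function.NonDependent.Propositional using (_×-⇔_)
open import Relation.Nullary using (¬_; Dec; yes; no)
open import Relation.Nullary.Decidable as Dec using (isYes; toWitness; fromWitness)
open import Relation.Unary using (Pred; _⊆_; _∪_; ｛_｝; ∅)
open import Relation.Binary.PropositionalEquality using (_≡_; refl; subst)

open Equivalence using (to; from)

-- Soundness is a routine induction on derivations, using excluded middle
-- for the classical connectives, closure of N(s) under extensional equality
-- for REΔ and ΔEqu, and (n) for ΔN.
--
-- For completeness, a maximal consistent set is represented as a Boolean
-- valuation of formulas (with the Δ-formulas as atoms) under which every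
-- theorem is true; Lindenbaum's lemma is propositional compactness along an
-- enumeration of the formulas.  In the canonical model X ∈ N(w) iff X is the
-- truth set of some ψ with Δψ ∈ w.  If Δχ ∈ w and the truth set of χ is that
-- of φ, then ⊢ χ ↔ φ, so Δφ ∈ w by REΔ; if it is the complement, Δ¬φ ∈ w
-- and ΔEqu applies.  Condition (n) holds because Δ⊤ is a theorem.

unary : ℕ → ℕᵇ → ℕᵇ
unary zero    k = 2[1+ k ]
unary (suc n) k = 1+[2 unary n k ]

unary-injective : ∀ m n {k l} → unary m k ≡ unary n l → m ≡ n × k ≡ l
unary-injective zero    zero    refl = refl , refl
unary-injective (suc m) (suc n) eq with unary-injective m n (1+[2_]-injective eq)
... | refl , k≡l = refl , k≡l

-- encode φ k prefixes the binary digits of k with a self-delimiting code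
-- of φ, whence injectivity.
encode : Form → ℕᵇ → ℕᵇ
encode (var p)  k = 2[1+ 2[1+ unary p k ] ]
encode (¬f φ)   k = 2[1+ 1+[2 encode φ k ] ]
encode (φ ∧f ψ) k = 1+[2 2[1+ encode φ (encode ψ k) ] ]
encode (Δ φ)    k = 1+[2 1+[2 encode φ k ] ]

encode-injective : ∀ φ ψ {k l} → encode φ k ≡ encode ψ l → φ ≡ ψ × k ≡ l
encode-injective (var p) (var q) eq
  with unary-injective p q (2[1+_]-injective (2[1+_]-injective eq))
... | refl , k≡l = refl , k≡l
encode-injective (¬f φ) (¬f ψ) eq
  with encode-injective φ ψ (1+[2_]-injective (2[1+_]-injective eq))
... | refl , k≡l = refl , k≡l
encode-injective (φ ∧f φ′) (ψ ∧f ψ′) eq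
  with encode-injective φ ψ (2[1+_]-injective (1+[2_]-injective eq))
... | refl , eq′ with encode-injective φ′ ψ′ eq′
...   | refl , k≡l = refl , k≡l
encode-injective (Δ φ) (Δ ψ) eq
  with encode-injective φ ψ (1+[2_]-injective (1+[2_]-injective eq))
... | refl , k≡l = refl , k≡l
encode-injective (var _)  (¬f _)   ()
encode-injective (var _)  (_ ∧f _) ()
encode-injective (var _)  (Δ _)    ()
encode-injective (¬f _)   (var _)  ()
encode-injective (¬f _)   (_ ∧f _) ()
encode-injective (¬f _)   (Δ _)    ()
encode-injective (_ ∧f _) (var _)  ()
encode-injective (_ ∧f _) (¬f _)   ()
encode-injective (_ ∧f _) (Δ _)    ()
encode-injective (Δ _)    (var _)  ()
encode-injective (Δ _)    (¬f _)   ()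
encode-injective (Δ _)    (_ ∧f _) ()

code : Form → ℕ
code φ = ℕᵇ.toℕ (encode φ ℕᵇ.zero)

code-injective : ∀ {φ ψ} → code φ ≡ code ψ → φ ≡ ψ
code-injective {φ} {ψ} = proj₁ ∘ encode-injective φ ψ ∘ toℕ-injective

infix 4 _⊨_

record _⊨_ (v : Form → Bool) (φ : Form) : Set where
  constructor ⟨_⟩
  field evaluatesTrue : T (evalB v φ)

open _⊨_

⊨⇔T : ∀ {v φ} → v ⊨ φ ⇔ T (evalB v φ)
⊨⇔T = mk⇔ evaluatesTrue ⟨_⟩

T-not : ∀ {b} → T (not b) ⇔ (¬ T b)
T-not {true}  = mk⇔ (λ ()) (λ f → f tt)
T-not {false} = mk⇔ (λ _ ()) (λ _ → tt)

module _ {v : Form → Bool} where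

  ⊨-¬ : ∀ {φ} → v ⊨ ¬f φ ⇔ (¬ v ⊨ φ)
  ⊨-¬ = mk⇔ (λ t u → to T-not (evaluatesTrue t) (evaluatesTrue u))
            (λ f → ⟨ from T-not (f ∘ ⟨_⟩) ⟩)

  ⊨-∧ : ∀ {φ ψ} → v ⊨ φ ∧f ψ ⇔ (v ⊨ φ × v ⊨ ψ)
  ⊨-∧ = mk⇔ (λ t → let a , b = to T-∧ (evaluatesTrue t) in ⟨ a ⟩ , ⟨ b ⟩)
            (λ (a , b) → ⟨ from T-∧ (evaluatesTrue a , evaluatesTrue b) ⟩)

  ⊨? : ∀ φ → Dec (v ⊨ φ)
  ⊨? φ = Dec.map (⇔.sym ⊨⇔T) (T? (evalB v φ))

  ⊨-⇒ : ∀ {φ ψ} → v ⊨ (φ ⇒f ψ) ⇔ (v ⊨ φ → v ⊨ ψ)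
  ⊨-⇒ {φ} {ψ} = mk⇔ modusPonens (λ f → from ⊨-¬ λ t → let a , b = to ⊨-∧ t in to ⊨-¬ b (f a))
    where
      modusPonens : v ⊨ (φ ⇒f ψ) → v ⊨ φ → v ⊨ ψ
      modusPonens t a with ⊨? ψ
      ... | yes b = b
      ... | no ¬b = ⊥-elim (to ⊨-¬ t (from ⊨-∧ (a , from ⊨-¬ ¬b)))

  ⊨-⇔ : ∀ {φ ψ} → v ⊨ (φ ⇔f ψ) ⇔ (v ⊨ φ ⇔ v ⊨ ψ)
  ⊨-⇔ = mk⇔ (λ t → let f , g = to ⊨-∧ t in mk⇔ (to ⊨-⇒ f) (to ⊨-⇒ g))
            (λ e → from ⊨-∧ (from ⊨-⇒ (to e) , from ⊨-⇒ (from e)))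

  ⊨-⊤ : v ⊨ ⊤f
  ⊨-⊤ = from ⊨-¬ λ t → let a , b = to ⊨-∧ t in to ⊨-¬ b a

  ⊨-conj : ∀ {xs} → v ⊨ conj xs ⇔ All (v ⊨_) xs
  ⊨-conj = mk⇔ conj⁻ conj⁺
    where
      conj⁻ : ∀ {xs} → v ⊨ conj xs → All (v ⊨_) xs
      conj⁻ {[]}     _ = []
      conj⁻ {x ∷ xs} t = let a , b = to ⊨-∧ t in a ∷ conj⁻ b
      conj⁺ : ∀ {xs} → All (v ⊨_) xs → v ⊨ conj xs
      conj⁺ []       = ⊨-⊤
      conj⁺ (a ∷ as) = from ⊨-∧ (a , conj⁺ as)

tautology : ∀ {φ} → (∀ v → v ⊨ φ) → Thm φ
tautology h = taut λ v → to T-≡ (evaluatesTrue (h v))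

record RespectsConnectives (P : Pred Form 0ℓ) : Set where
  field
    respects-¬ : ∀ {φ} → P (¬f φ) ⇔ (¬ P φ)
    respects-∧ : ∀ {φ ψ} → P (φ ∧f ψ) ⇔ (P φ × P ψ)

open RespectsConnectives

⊨-respectsConnectives : ∀ {v} → RespectsConnectives (v ⊨_)
⊨-respectsConnectives = record { respects-¬ = ⊨-¬ ; respects-∧ = ⊨-∧ }

agreeOnAtoms⇒agree : ∀ {P Q} → RespectsConnectives P → RespectsConnectives Q →
                     (∀ p → P (var p) ⇔ Q (var p)) → (∀ φ → P (Δ φ) ⇔ Q (Δ φ)) →
                     ∀ φ → P φ ⇔ Q φ
agreeOnAtoms⇒agree {P} {Q} RP RQ onVar onΔ = agree
  where
    agree : ∀ φ → P φ ⇔ Q φ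
    agree (var p)  = onVar p
    agree (¬f φ)   = ⇔.trans (respects-¬ RP) (⇔.trans (¬-cong-⇔ (agree φ)) (⇔.sym (respects-¬ RQ)))
    agree (φ ∧f ψ) = ⇔.trans (respects-∧ RP) (⇔.trans (agree φ ×-⇔ agree ψ) (⇔.sym (respects-∧ RQ)))
    agree (Δ φ)    = onΔ φ

conj-thm : ∀ {θs} → All Thm θs → Thm (conj θs)
conj-thm []       = tautology λ _ → ⊨-⊤
conj-thm (t ∷ ts) =
  mp (mp (tautology λ _ → from ⊨-⇒ λ a → from ⊨-⇒ λ b → from ⊨-∧ (a , b)) t) (conj-thm ts)

⊢-by-tautology : ∀ {Γ φ θs γs} → All Thm θs → All Γ γs →
          (∀ v → All (v ⊨_) θs → All (v ⊨_) γs → v ⊨ φ) → Γ ⊢ φ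
⊢-by-tautology {φ = φ} {θs} {γs} thms hyps entails = γs , hyps , mp premises⇒φ (conj-thm thms)
  where
    premises⇒φ : Thm (conj θs ⇒f conj γs ⇒f φ)
    premises⇒φ = tautology λ v → from ⊨-⇒ λ tθ → from ⊨-⇒ λ tγ →
                   entails v (to ⊨-conj tθ) (to ⊨-conj tγ)

∅⊢⇒Thm : ∀ {φ} → ∅ ⊢ φ → Thm φ
∅⊢⇒Thm ([] , [] , ⊤⇒φ) = mp ⊤⇒φ (tautology λ _ → ⊨-⊤)
∅⊢⇒Thm (_ ∷ _ , () ∷ _ , _)

record World : Set where
  field
    valuation     : Form → Bool
    theorems-hold : ∀ {θ} → Thm θ → valuation ⊨ θ

open World

infix 4 _∋_

_∋_ : World → Form → Set
w ∋ φ = valuation w ⊨ φ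

∋-⇔ : ∀ w {φ ψ} → Thm (φ ⇔f ψ) → w ∋ φ ⇔ w ∋ ψ
∋-⇔ w = to ⊨-⇔ ∘ theorems-hold w

split-∪ : ∀ {A : Set} {P Q : Pred A 0ℓ} {xs} → All (P ∪ Q) xs →
          ∃₂ λ ys zs → All P ys × All Q zs × (∀ {R : Pred A 0ℓ} → All R (ys ++ zs) → All R xs)
split-∪ [] = [] , [] , [] , [] , λ _ → []
split-∪ {xs = x ∷ _} (inj₁ px ∷ pqs) with split-∪ pqs
... | ys , zs , ps , qs , cover = x ∷ ys , zs , px ∷ ps , qs , λ { (r ∷ rs) → r ∷ cover rs }
split-∪ {xs = x ∷ xs} (inj₂ qx ∷ pqs) with split-∪ pqs
... | ys , zs , ps , qs , cover = ys , x ∷ zs , ps , qx ∷ qs , cover′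
  where
    cover′ : ∀ {R} → All R (ys ++ x ∷ zs) → All R (x ∷ xs)
    cover′ rs with ++⁻ʳ ys rs
    ... | r ∷ rzs = r ∷ cover (++⁺ (++⁻ˡ ys rs) rzs)

All-｛｝ : ∀ {A : Set} {R : Pred A 0ℓ} {a xs} → All ｛ a ｝ xs → R a → All R xs
All-｛｝ as r = All.map (λ { refl → r }) as

module Model (F : Frame) (V : Valuation F) where

  N-cong : ∀ {s X Y} → (∀ t → X t ⇔ Y t) → N F s X → N F s Y
  N-cong X⇔Y = N-ext F _ _ _ λ t → to (X⇔Y t) , from (X⇔Y t)

  infix 4 _⊩_

  _⊩_ : S F → Form → Set
  s ⊩ φ = sat F V s φ

  ⊩-respectsConnectives : ∀ {s} → RespectsConnectives (s ⊩_)
  ⊩-respectsConnectives = record { respects-¬ = ⇔.refl ; respects-∧ = ⇔.refl }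

  ⊩-⊤ : ∀ {s} → s ⊩ ⊤f
  ⊩-⊤ (a , ¬a) = ¬a a

  ⊩-Δ-cong : ∀ {s φ ψ} → (∀ t → t ⊩ φ ⇔ t ⊩ ψ) → s ⊩ Δ φ ⇔ s ⊩ Δ ψ
  ⊩-Δ-cong φ⇔ψ = mk⇔ (Sum.map (N-cong φ⇔ψ) (N-cong (¬-cong-⇔ ∘ φ⇔ψ)))
                     (Sum.map (N-cong (⇔.sym ∘ φ⇔ψ)) (N-cong (⇔.sym ∘ ¬-cong-⇔ ∘ φ⇔ψ)))

module Classical (lem : LEM) where

  dne : ∀ {A : Set} → ¬ ¬ A → A
  dne {A} ¬¬a with lem A
  ... | yes a = a
  ... | no ¬a = ⊥-elim (¬¬a ¬a)

  valuationOf : Pred Form 0ℓ → Form → Bool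
  valuationOf P = isYes ∘ lem ∘ P

  ⊨-valuationOf : ∀ {P} → RespectsConnectives P → ∀ φ → valuationOf P ⊨ φ ⇔ P φ
  ⊨-valuationOf {P} R =
    agreeOnAtoms⇒agree ⊨-respectsConnectives R (λ _ → ⇔.trans ⊨⇔T atom) (λ _ → ⇔.trans ⊨⇔T atom)
    where
      atom : ∀ {a} → T (valuationOf P a) ⇔ P a
      atom = mk⇔ toWitness fromWitness

  module ClassicalModel (F : Frame) (V : Valuation F) where

    open Model F V

    ⊩-⇒ : ∀ {s φ ψ} → s ⊩ (φ ⇒f ψ) ⇔ (s ⊩ φ → s ⊩ ψ)
    ⊩-⇒ = mk⇔ (λ φ⇒ψ a → dne λ ¬b → φ⇒ψ (a , ¬b)) (λ f (a , ¬b) → ¬b (f a))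

    ⊩-⇔ : ∀ {s φ ψ} → s ⊩ (φ ⇔f ψ) ⇔ (s ⊩ φ ⇔ s ⊩ ψ)
    ⊩-⇔ {s} {φ} {ψ} = mk⇔ (λ (f , g) → mk⇔ (to φ⇒ψ f) (to ψ⇒φ g))
                          (λ e → from φ⇒ψ (to e) , from ψ⇒φ (from e))
      where
        φ⇒ψ : s ⊩ (φ ⇒f ψ) ⇔ (s ⊩ φ → s ⊩ ψ)
        φ⇒ψ = ⊩-⇒ {s} {φ} {ψ}
        ψ⇒φ : s ⊩ (ψ ⇒f φ) ⇔ (s ⊩ ψ → s ⊩ φ)
        ψ⇒φ = ⊩-⇒ {s} {ψ} {φ}

    ⊩-Δ¬ : ∀ {s φ} → s ⊩ Δ φ ⇔ s ⊩ Δ (¬f φ)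
    ⊩-Δ¬ {φ = φ} = mk⇔ (Sum.swap ∘ Sum.map₁ (N-cong φ⇔¬¬φ))
                       (Sum.swap ∘ Sum.map₂ (N-cong (⇔.sym ∘ φ⇔¬¬φ)))
      where
        φ⇔¬¬φ : ∀ t → t ⊩ φ ⇔ t ⊩ ¬f (¬f φ)
        φ⇔¬¬φ t = mk⇔ (λ a ¬a → ¬a a) dne

    theorem-valid : HasN F → ∀ {φ} → Thm φ → ∀ s → s ⊩ φ
    theorem-valid _ {φ} (taut tautological) s =
      to (⊨-valuationOf ⊩-respectsConnectives φ) ⟨ from T-≡ (tautological (valuationOf (s ⊩_))) ⟩
    theorem-valid _ (ΔEqu {φ}) s = from (⊩-⇔ {s} {Δ φ} {Δ (¬f φ)}) (⊩-Δ¬ {s} {φ})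
    theorem-valid hasN ΔN s = inj₁ (N-cong (λ _ → mk⇔ (λ _ → ⊩-⊤) _) (hasN s))
    theorem-valid hasN (mp {φ} {ψ} φ⇒ψ φ′) s =
      to (⊩-⇒ {s} {φ} {ψ}) (theorem-valid hasN φ⇒ψ s) (theorem-valid hasN φ′ s)
    theorem-valid hasN (REΔ {φ} {ψ} φ⇔ψ) s =
      from (⊩-⇔ {s} {Δ φ} {Δ ψ}) (⊩-Δ-cong {s} {φ} {ψ} same-truth-set)
      where
        same-truth-set : ∀ t → t ⊩ φ ⇔ t ⊩ ψ
        same-truth-set t = to (⊩-⇔ {t} {φ} {ψ}) (theorem-valid hasN φ⇔ψ t)

  soundness : Sound
  soundness _ thm F hasN V = ClassicalModel.theorem-valid F V hasN thm

  Satisfiable : List Form → Set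
  Satisfiable xs = ∃ λ v → All (v ⊨_) xs

  FinitelySatisfiable : Pred Form 0ℓ → Set
  FinitelySatisfiable Φ = ∀ {xs} → All Φ xs → Satisfiable xs

  FinitelySatisfiable-extend : ∀ {Φ} → FinitelySatisfiable Φ → ∀ ψ →
    FinitelySatisfiable (Φ ∪ ｛ ψ ｝) ⊎ FinitelySatisfiable (Φ ∪ ｛ ¬f ψ ｝)
  FinitelySatisfiable-extend {Φ} finSat ψ with lem (FinitelySatisfiable (Φ ∪ ｛ ψ ｝))
  ... | yes finSatψ = inj₁ finSatψ
  ... | no ¬finSatψ = inj₂ λ in¬ψ → dne λ unsat¬ψ → ¬finSatψ λ inψ → satisfy in¬ψ unsat¬ψ inψ
    where
      satisfy : ∀ {xs ys} → All (Φ ∪ ｛ ¬f ψ ｝) xs → ¬ Satisfiable xs →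
                All (Φ ∪ ｛ ψ ｝) ys → Satisfiable ys
      satisfy in¬ψ unsat inψ with split-∪ in¬ψ | split-∪ inψ
      ... | xs₀ , _ , inΦ , ¬ψs , cover | ys₀ , _ , inΦ′ , ψs , cover′
          with finSat (++⁺ inΦ inΦ′)
      ... | v , sat₀ with ⊨? {v} ψ
      ...   | yes vψ = v , cover′ (++⁺ (++⁻ʳ xs₀ sat₀) (All-｛｝ ψs vψ))
      ...   | no ¬vψ =
        ⊥-elim (unsat (v , cover (++⁺ (++⁻ˡ xs₀ sat₀) (All-｛｝ ¬ψs (from ⊨-¬ ¬vψ)))))

  enumerate : ℕ → Form
  enumerate n with lem (∃ λ φ → code φ ≡ n)
  ... | yes (φ , _) = φ
  ... | no _        = ⊤f

  enumerate-code : ∀ φ → enumerate (code φ) ≡ φ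
  enumerate-code φ with lem (∃ λ ψ → code ψ ≡ code φ)
  ... | yes (ψ , codeψ≡codeφ) = code-injective codeψ≡codeφ
  ... | no ∄ψ                 = ⊥-elim (∄ψ (φ , refl))

  module Completion (Φ₀ : Pred Form 0ℓ) (finSat₀ : FinitelySatisfiable Φ₀) where

    Stage : Set₁
    Stage = Σ (Pred Form 0ℓ) FinitelySatisfiable

    extend : Stage → Form → Stage
    extend (Φ , finSat) ψ =
      [ (λ finSatψ → Φ ∪ ｛ ψ ｝ , finSatψ) , (λ finSat¬ψ → Φ ∪ ｛ ¬f ψ ｝ , finSat¬ψ) ]′
        (FinitelySatisfiable-extend finSat ψ)

    extend-⊇ : ∀ σ ψ → proj₁ σ ⊆ proj₁ (extend σ ψ)
    extend-⊇ (Φ , finSat) ψ with FinitelySatisfiable-extend finSat ψ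
    ... | inj₁ _ = inj₁
    ... | inj₂ _ = inj₁

    extend-decides : ∀ σ ψ → proj₁ (extend σ ψ) ψ ⊎ proj₁ (extend σ ψ) (¬f ψ)
    extend-decides (Φ , finSat) ψ with FinitelySatisfiable-extend finSat ψ
    ... | inj₁ _ = inj₁ (inj₂ refl)
    ... | inj₂ _ = inj₂ (inj₂ refl)

    stage : ℕ → Stage
    stage zero    = Φ₀ , finSat₀
    stage (suc n) = extend (stage n) (enumerate n)

    layer : ℕ → Pred Form 0ℓ
    layer = proj₁ ∘ stage

    layer-mono : ∀ {m n} → m ≤′ n → layer m ⊆ layer n
    layer-mono ≤′-refl                  φ∈ = φ∈
    layer-mono (≤′-step {n} m≤′n) φ∈ = extend-⊇ (stage n) (enumerate n) (layer-mono m≤′n φ∈)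

    Limit : Pred Form 0ℓ
    Limit φ = ∃ λ n → layer n φ

    Limit-bounded : ∀ {xs} → All Limit xs → ∃ λ n → All (layer n) xs
    Limit-bounded []                 = zero , []
    Limit-bounded ((m , inₘ) ∷ inLimit) with Limit-bounded inLimit
    ... | n , inₙ =
      m ⊔ n , layer-mono (≤⇒≤′ (m≤m⊔n m n)) inₘ ∷ All.map (layer-mono (≤⇒≤′ (m≤n⊔m m n))) inₙ

    Limit-finitelySatisfiable : FinitelySatisfiable Limit
    Limit-finitelySatisfiable inLimit = let n , inₙ = Limit-bounded inLimit in proj₂ (stage n) inₙ

    Limit-decides : ∀ φ → Limit φ ⊎ Limit (¬f φ)
    Limit-decides φ with extend-decides (stage (code φ)) (enumerate (code φ))
    ... | inj₁ φ∈  = inj₁ (suc (code φ) , subst (layer (suc (code φ))) (enumerate-code φ) φ∈)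
    ... | inj₂ ¬φ∈ = inj₂ (suc (code φ) , subst (layer (suc (code φ)) ∘ ¬f_) (enumerate-code φ) ¬φ∈)

    Limit-closed : ∀ {xs ψ} → All Limit xs → (∀ v → All (v ⊨_) xs → v ⊨ ψ) → Limit ψ
    Limit-closed {ψ = ψ} inLimit entails with Limit-decides ψ
    ... | inj₁ ψ∈ = ψ∈
    ... | inj₂ ¬ψ∈ with Limit-finitelySatisfiable (¬ψ∈ ∷ inLimit)
    ...   | v , v¬ψ ∷ vxs = ⊥-elim (to ⊨-¬ v¬ψ (entails v vxs))

    Limit-consistent : ∀ {φ} → Limit φ → ¬ Limit (¬f φ)
    Limit-consistent φ∈ ¬φ∈ with Limit-finitelySatisfiable (φ∈ ∷ ¬φ∈ ∷ [])
    ... | _ , vφ ∷ v¬φ ∷ [] = to ⊨-¬ v¬φ vφ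

    Limit-complete : ∀ {φ} → ¬ Limit φ → Limit (¬f φ)
    Limit-complete {φ} φ∉ = [ (λ φ∈ → ⊥-elim (φ∉ φ∈)) , (λ ¬φ∈ → ¬φ∈) ]′ (Limit-decides φ)

    Limit-respectsConnectives : RespectsConnectives Limit
    Limit-respectsConnectives = record
      { respects-¬ = mk⇔ (λ ¬φ∈ φ∈ → Limit-consistent φ∈ ¬φ∈) Limit-complete
      ; respects-∧ = mk⇔
          (λ φ∧ψ∈ → Limit-closed (φ∧ψ∈ ∷ []) (λ { _ (vφ∧ψ ∷ []) → proj₁ (to ⊨-∧ vφ∧ψ) })
                  , Limit-closed (φ∧ψ∈ ∷ []) (λ { _ (vφ∧ψ ∷ []) → proj₂ (to ⊨-∧ vφ∧ψ) }))
          (λ (φ∈ , ψ∈) → Limit-closed (φ∈ ∷ ψ∈ ∷ []) λ { _ (vφ ∷ vψ ∷ []) → from ⊨-∧ (vφ , vψ) })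
      }

  compactness : ∀ {Φ} → FinitelySatisfiable Φ → ∃ λ v → ∀ {φ} → Φ φ → v ⊨ φ
  compactness {Φ} finSat =
    valuationOf Limit , λ {φ} φ∈ → from (⊨-valuationOf Limit-respectsConnectives φ) (zero , φ∈)
    where open Completion Φ finSat

  lindenbaum : ∀ {Γ φ} → ¬ (Γ ⊢ φ) → ∃ λ w → (∀ {γ} → Γ γ → w ∋ γ) × ¬ (w ∋ φ)
  lindenbaum {Γ} {φ} Γ⊬φ =
    let v , v⊨ = compactness finSat
    in  record { valuation = v ; theorems-hold = v⊨ ∘ inj₁ ∘ inj₁ }
      , v⊨ ∘ inj₁ ∘ inj₂
      , to ⊨-¬ (v⊨ (inj₂ refl))
    where
      derive : ∀ {xs} → All ((Thm ∪ Γ) ∪ ｛ ¬f φ ｝) xs → ¬ Satisfiable xs → Γ ⊢ φ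
      derive inΦ unsat with split-∪ inΦ
      ... | _ , _ , inThm∪Γ , ¬φs , cover with split-∪ inThm∪Γ
      ...   | _ , _ , thms , hyps , cover′ = ⊢-by-tautology thms hyps λ v vθs vγs → dne λ ¬vφ →
              unsat (v , cover (++⁺ (cover′ (++⁺ vθs vγs)) (All-｛｝ ¬φs (from ⊨-¬ ¬vφ))))

      finSat : FinitelySatisfiable ((Thm ∪ Γ) ∪ ｛ ¬f φ ｝)
      finSat inΦ = dne (Γ⊬φ ∘ derive inΦ)

  valid⇒Thm : ∀ {θ} → (∀ w → w ∋ θ) → Thm θ
  valid⇒Thm valid = dne λ ⊬θ → let w , _ , θ∉w = lindenbaum (⊬θ ∘ ∅⊢⇒Thm) in θ∉w (valid w)

  ∋-Δ-cong : ∀ {φ ψ} → (∀ u → u ∋ φ ⇔ u ∋ ψ) → ∀ w → w ∋ Δ φ → w ∋ Δ ψ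
  ∋-Δ-cong φ⇔ψ w = to (∋-⇔ w (REΔ (valid⇒Thm λ u → from ⊨-⇔ (φ⇔ψ u))))

  module Canonical (w₀ : World) where

    Neighbourhood : World → Pred World 0ℓ → Set
    Neighbourhood w X = ∃ λ ψ → w ∋ Δ ψ × (∀ u → X u ⇔ u ∋ ψ)

    frame : Frame
    frame = record
      { S     = World
      ; point = w₀
      ; N     = Neighbourhood
      ; N-ext = λ _ _ _ X≐Y (ψ , Δψ∈ , X⇔ψ) →
                  ψ , Δψ∈ , λ u → ⇔.trans (mk⇔ (proj₂ (X≐Y u)) (proj₁ (X≐Y u))) (X⇔ψ u)
      }

    frame-hasN : HasN frame
    frame-hasN w = ⊤f , theorems-hold w ΔN , λ _ → mk⇔ (λ _ → ⊨-⊤) _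

    V : Valuation frame
    V p w = w ∋ var p

    truth-lemma : ∀ w φ → sat frame V w φ ⇔ w ∋ φ
    truth-lemma w (var p)  = ⇔.refl
    truth-lemma w (¬f φ)   = ⇔.trans (¬-cong-⇔ (truth-lemma w φ)) (⇔.sym ⊨-¬)
    truth-lemma w (φ ∧f ψ) = ⇔.trans (truth-lemma w φ ×-⇔ truth-lemma w ψ) (⇔.sym ⊨-∧)
    truth-lemma w (Δ φ)    = mk⇔ Δ-truth (λ Δφ∈ → inj₁ (φ , Δφ∈ , λ u → truth-lemma u φ))
      where
        ¬-truth : ∀ u → (¬ sat frame V u φ) ⇔ u ∋ ¬f φ
        ¬-truth u = ⇔.trans (¬-cong-⇔ (truth-lemma u φ)) (⇔.sym ⊨-¬)

        Δ-truth : sat frame V w (Δ φ) → w ∋ Δ φ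
        Δ-truth (inj₁ (χ , Δχ∈ , φ⇔χ)) =
          ∋-Δ-cong (λ u → ⇔.trans (⇔.sym (φ⇔χ u)) (truth-lemma u φ)) w Δχ∈
        Δ-truth (inj₂ (χ , Δχ∈ , ¬φ⇔χ)) =
          from (∋-⇔ w ΔEqu) (∋-Δ-cong (λ u → ⇔.trans (⇔.sym (¬φ⇔χ u)) (¬-truth u)) w Δχ∈)

  completeness : StronglyComplete
  completeness Γ φ Γ⊨φ with lem (Γ ⊢ φ)
  ... | yes Γ⊢φ = Γ⊢φ
  ... | no Γ⊬φ with lindenbaum Γ⊬φ
  ...   | w , Γ∈w , φ∉w = ⊥-elim (φ∉w (to (truth-lemma w φ) φ-true))
    where
      open Canonical w
      φ-true : sat frame V w φ
      φ-true = Γ⊨φ frame frame-hasN V w λ γ Γγ → from (truth-lemma w γ) (Γ∈w Γγ)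

mainTheorem4 : LEM → Sound × StronglyComplete
mainTheorem4 lem = soundness , completeness
  where open Classical lem
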